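{- For every positive integer $n$, the following identity holds in $x$: $$\sum_{r=0}^{n-1}\frac{(1-x)^r}{r+1} = \sum_{r=0}^{n-1}\binom{n}{r+1}\frac{(-1)^r}{r+1}\cdot\frac{x^{r+1}-1}{x-1},$$ where $\frac{x^{r+1}-1}{x-1}$ denotes the polynomial $1+x+\cdots+x^r$. -}

module Defs where

open import Data.Nat using (ℕ; zero; suc)
open import Data.Integer using (+_)
open import Data.Rational using (ℚ; 0ℚ; 1ℚ; _+_; _*_; _/_)

pow : ℚ → ℕ → ℚ
pow x zero = 1ℚ
pow x (suc k) = x * pow x k

sumTo : ℕ → (ℕ → ℚ) → ℚ
sumTo zero f = 0ℚ
sumTo (suc n) f = sumTo n f + f n

ℕtoℚ : ℕ → ℚ
ℕtoℚ k = (+ k) / 1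

inv1+ : ℕ → ℚ
inv1+ r = (+ 1) / suc r

-- the polynomial (x^(r+1) - 1)/(x - 1) = 1 + x + ... + x^r
geom : ℚ → ℕ → ℚ
geom x r = sumTo (suc r) (pow x)

-- Let B = binomialTransform, B n G = Σ_{r<n} C(n,r+1) (-1)^r G r.  Pascal's rule gives
-- B (n+1) G = G 0 - B n (G ∘ suc) + B n G.  Hence B (n+1) 1 = 1, and the geometric
-- partial sums G = geom y, for which G (r+1) = 1 + y G r, satisfy
-- B (n+2) G = (1 - y) B (n+1) G, i.e. B (n+1) G = (1 - y)^n.  The right-hand side is
-- B n (r ↦ geom x r/(r+1)); by the absorption identity C(n,r)/(r+1) = C(n+1,r+1)/(n+1)
-- it grows from n to n+1 by B (n+1) (geom x)/(n+1) = (1 - x)^n/(n+1), as does the left-hand side.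
module Submission where

open import Defs
open import Function.Base using (_∘_)
open import Data.Nat as ℕ using (ℕ; zero; suc; _≥_)
import Data.Nat.Properties as ℕ
open import Data.Nat.Combinatorics using (_C_; nC1≡n; nCk+nC[k+1]≡[n+1]C[k+1])
open import Data.Nat.Combinatorics.Specification using (k>n⇒nCk≡0)
open import Data.Nat.Coprimality using (1-coprimeTo) renaming (sym to coprime-sym)
open import Data.Integer using (+_)
import Data.Integer.Properties as ℤ
open import Data.Rational using (ℚ; mkℚ; 0ℚ; 1ℚ; _+_; _*_; _-_; -_)
open import Data.Rational.Properties
open import Relation.Binary.PropositionalEquality
open import Algebra.Properties.Ring +-*-ring using (-1*x≈-x)
open import Data.Rational.Solver using (module +-*-Solver)

open ≡-Reasoning
open +-*-Solver using (solve; _:=_; _:+_; _:*_; _:-_; con)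

ℕtoℚ≡mkℚ : ∀ k → ℕtoℚ k ≡ mkℚ (+ k) 0 (coprime-sym (1-coprimeTo k))
ℕtoℚ≡mkℚ k = normalize-coprime (coprime-sym (1-coprimeTo k))

ℕtoℚ-suc : ∀ k → ℕtoℚ (suc k) ≡ 1ℚ + ℕtoℚ k
ℕtoℚ-suc k rewrite ℕtoℚ≡mkℚ k | ℤ.*-identityʳ (+ k) = refl

ℕtoℚ-+ : ∀ m n → ℕtoℚ (m ℕ.+ n) ≡ ℕtoℚ m + ℕtoℚ n
ℕtoℚ-+ zero    n = sym (+-identityˡ (ℕtoℚ n))
ℕtoℚ-+ (suc m) n = begin
  ℕtoℚ (suc (m ℕ.+ n))          ≡⟨ ℕtoℚ-suc (m ℕ.+ n) ⟩
  1ℚ + ℕtoℚ (m ℕ.+ n)           ≡⟨ cong (_+_ 1ℚ) (ℕtoℚ-+ m n) ⟩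
  1ℚ + (ℕtoℚ m + ℕtoℚ n)        ≡⟨ +-assoc 1ℚ (ℕtoℚ m) (ℕtoℚ n) ⟨
  (1ℚ + ℕtoℚ m) + ℕtoℚ n        ≡⟨ cong (_+ ℕtoℚ n) (ℕtoℚ-suc m) ⟨
  ℕtoℚ (suc m) + ℕtoℚ n         ∎

ℕtoℚ-* : ∀ m n → ℕtoℚ (m ℕ.* n) ≡ ℕtoℚ m * ℕtoℚ n
ℕtoℚ-* zero    n = sym (*-zeroˡ (ℕtoℚ n))
ℕtoℚ-* (suc m) n = begin
  ℕtoℚ (n ℕ.+ m ℕ.* n)              ≡⟨ ℕtoℚ-+ n (m ℕ.* n) ⟩
  ℕtoℚ n + ℕtoℚ (m ℕ.* n)           ≡⟨ cong (_+_ (ℕtoℚ n)) (ℕtoℚ-* m n) ⟩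
  ℕtoℚ n + ℕtoℚ m * ℕtoℚ n          ≡⟨ cong (_+ ℕtoℚ m * ℕtoℚ n) (*-identityˡ (ℕtoℚ n)) ⟨
  1ℚ * ℕtoℚ n + ℕtoℚ m * ℕtoℚ n     ≡⟨ *-distribʳ-+ (ℕtoℚ n) 1ℚ (ℕtoℚ m) ⟨
  (1ℚ + ℕtoℚ m) * ℕtoℚ n            ≡⟨ cong (_* ℕtoℚ n) (ℕtoℚ-suc m) ⟨
  ℕtoℚ (suc m) * ℕtoℚ n             ∎

ℕtoℚ-suc-*-inv1+ : ∀ r → ℕtoℚ (suc r) * inv1+ r ≡ 1ℚ
ℕtoℚ-suc-*-inv1+ r
  rewrite ℕtoℚ≡mkℚ (suc r) | normalize-coprime (1-coprimeTo (suc r))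
  = *-inverseʳ (mkℚ (+ suc r) 0 (coprime-sym (1-coprimeTo (suc r))))

[k+1]*[n+1]C[k+1]≡[n+1]*nCk : ∀ n k → suc k ℕ.* (suc n C suc k) ≡ suc n ℕ.* (n C k)
[k+1]*[n+1]C[k+1]≡[n+1]*nCk zero    zero    = refl
[k+1]*[n+1]C[k+1]≡[n+1]*nCk zero    (suc k) = ℕ.*-zeroʳ (suc (suc k))
[k+1]*[n+1]C[k+1]≡[n+1]*nCk (suc n) zero    = begin
  1 ℕ.* (suc (suc n) C 1)   ≡⟨ ℕ.*-identityˡ _ ⟩
  suc (suc n) C 1           ≡⟨ nC1≡n (suc (suc n)) ⟩
  suc (suc n)               ≡⟨ ℕ.*-identityʳ (suc (suc n)) ⟨
  suc (suc n) ℕ.* 1         ∎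
[k+1]*[n+1]C[k+1]≡[n+1]*nCk (suc n) (suc k) = begin
  suc (suc k) ℕ.* (suc (suc n) C suc (suc k))
    ≡⟨ cong (suc (suc k) ℕ.*_) (nCk+nC[k+1]≡[n+1]C[k+1] (suc n) (suc k)) ⟨
  suc (suc k) ℕ.* (A ℕ.+ B)
    ≡⟨ ℕ.*-distribˡ-+ (suc (suc k)) A B ⟩
  A ℕ.+ suc k ℕ.* A ℕ.+ suc (suc k) ℕ.* B
    ≡⟨ cong₂ (λ u v → A ℕ.+ u ℕ.+ v) ([k+1]*[n+1]C[k+1]≡[n+1]*nCk n k)
                                    ([k+1]*[n+1]C[k+1]≡[n+1]*nCk n (suc k)) ⟩
  A ℕ.+ suc n ℕ.* (n C k) ℕ.+ suc n ℕ.* (n C suc k)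
    ≡⟨ ℕ.+-assoc A _ _ ⟩
  A ℕ.+ (suc n ℕ.* (n C k) ℕ.+ suc n ℕ.* (n C suc k))
    ≡⟨ cong (A ℕ.+_) (ℕ.*-distribˡ-+ (suc n) (n C k) (n C suc k)) ⟨
  A ℕ.+ suc n ℕ.* (n C k ℕ.+ n C suc k)
    ≡⟨ cong (λ u → A ℕ.+ suc n ℕ.* u) (nCk+nC[k+1]≡[n+1]C[k+1] n k) ⟩
  suc (suc n) ℕ.* A
    ∎
  where
  A B : ℕ
  A = suc n C suc k
  B = suc n C suc (suc k)

nCk/[k+1]≡[n+1]C[k+1]/[n+1] : ∀ n k → ℕtoℚ (n C k) * inv1+ k ≡ inv1+ n * ℕtoℚ (suc n C suc k)
nCk/[k+1]≡[n+1]C[k+1]/[n+1] n k = begin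
  c * i                 ≡⟨ *-identityˡ (c * i) ⟨
  1ℚ * (c * i)          ≡⟨ cong (_* (c * i)) (ℕtoℚ-suc-*-inv1+ n) ⟨
  (N * j) * (c * i)     ≡⟨ solve 4 (λ N j c i → (N :* j) :* (c :* i) := j :* i :* (N :* c)) refl N j c i ⟩
  j * i * (N * c)       ≡⟨ cong (j * i *_) Nc≡Rd ⟩
  j * i * (R * d)       ≡⟨ solve 4 (λ j i R d → j :* i :* (R :* d) := j :* d :* (R :* i)) refl j i R d ⟩
  j * d * (R * i)       ≡⟨ cong (j * d *_) (ℕtoℚ-suc-*-inv1+ k) ⟩
  j * d * 1ℚ            ≡⟨ *-identityʳ (j * d) ⟩
  j * d                 ∎
  where
  c d R N i j : ℚ
  c = ℕtoℚ (n C k)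
  d = ℕtoℚ (suc n C suc k)
  R = ℕtoℚ (suc k)
  N = ℕtoℚ (suc n)
  i = inv1+ k
  j = inv1+ n
  Nc≡Rd : N * c ≡ R * d
  Nc≡Rd = begin
    N * c                              ≡⟨ ℕtoℚ-* (suc n) (n C k) ⟨
    ℕtoℚ (suc n ℕ.* (n C k))           ≡⟨ cong ℕtoℚ ([k+1]*[n+1]C[k+1]≡[n+1]*nCk n k) ⟨
    ℕtoℚ (suc k ℕ.* (suc n C suc k))   ≡⟨ ℕtoℚ-* (suc k) (suc n C suc k) ⟩
    R * d                              ∎

sumTo-cong : ∀ n {f g : ℕ → ℚ} → (∀ r → f r ≡ g r) → sumTo n f ≡ sumTo n g
sumTo-cong zero    f≗g = refl
sumTo-cong (suc n) f≗g = cong₂ _+_ (sumTo-cong n f≗g) (f≗g n)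

sumTo-+ : ∀ n (f g : ℕ → ℚ) → sumTo n (λ r → f r + g r) ≡ sumTo n f + sumTo n g
sumTo-+ zero    f g = refl
sumTo-+ (suc n) f g = begin
  sumTo n (λ r → f r + g r) + (f n + g n)        ≡⟨ cong (_+ (f n + g n)) (sumTo-+ n f g) ⟩
  (sumTo n f + sumTo n g) + (f n + g n)          ≡⟨ solve 4 (λ a b c d → (a :+ b) :+ (c :+ d) := (a :+ c) :+ (b :+ d))
                                                           refl (sumTo n f) (sumTo n g) (f n) (g n) ⟩
  (sumTo n f + f n) + (sumTo n g + g n)          ∎

sumTo-*ˡ : ∀ n c (f : ℕ → ℚ) → sumTo n (λ r → c * f r) ≡ c * sumTo n f
sumTo-*ˡ zero    c f = sym (*-zeroʳ c)
sumTo-*ˡ (suc n) c f = begin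
  sumTo n (λ r → c * f r) + c * f n    ≡⟨ cong (_+ c * f n) (sumTo-*ˡ n c f) ⟩
  c * sumTo n f + c * f n              ≡⟨ *-distribˡ-+ c (sumTo n f) (f n) ⟨
  c * (sumTo n f + f n)                ∎

sumTo-suc : ∀ n (f : ℕ → ℚ) → sumTo (suc n) f ≡ f 0 + sumTo n (f ∘ suc)
sumTo-suc zero    f = +-comm 0ℚ (f 0)
sumTo-suc (suc n) f = begin
  sumTo (suc n) f + f (suc n)                 ≡⟨ cong (_+ f (suc n)) (sumTo-suc n f) ⟩
  (f 0 + sumTo n (f ∘ suc)) + f (suc n)       ≡⟨ +-assoc (f 0) (sumTo n (f ∘ suc)) (f (suc n)) ⟩
  f 0 + sumTo (suc n) (f ∘ suc)               ∎

geom-suc : ∀ x r → geom x (suc r) ≡ 1ℚ + x * geom x r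
geom-suc x r = trans (sumTo-suc (suc r) (pow x)) (cong (_+_ 1ℚ) (sumTo-*ˡ (suc r) x (pow x)))

binomialTransform : ℕ → (ℕ → ℚ) → ℚ
binomialTransform n G = sumTo n (λ r → ℕtoℚ (n C suc r) * (pow (- 1ℚ) r * G r))

binomialTransform-cong : ∀ n {F G : ℕ → ℚ} → (∀ r → F r ≡ G r) →
                         binomialTransform n F ≡ binomialTransform n G
binomialTransform-cong n F≗G =
  sumTo-cong n (λ r → cong (λ t → ℕtoℚ (n C suc r) * (pow (- 1ℚ) r * t)) (F≗G r))

binomialTransform-linear : ∀ n (F : ℕ → ℚ) c G →
  binomialTransform n (λ r → F r + c * G r) ≡ binomialTransform n F + c * binomialTransform n G
binomialTransform-linear n F c G = begin
  binomialTransform n (λ r → F r + c * G r)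
    ≡⟨ sumTo-cong n distribute ⟩
  sumTo n (λ r → ℕtoℚ (n C suc r) * (pow (- 1ℚ) r * F r) + c * (ℕtoℚ (n C suc r) * (pow (- 1ℚ) r * G r)))
    ≡⟨ sumTo-+ n _ _ ⟩
  binomialTransform n F + sumTo n (λ r → c * (ℕtoℚ (n C suc r) * (pow (- 1ℚ) r * G r)))
    ≡⟨ cong (_+_ (binomialTransform n F)) (sumTo-*ˡ n c _) ⟩
  binomialTransform n F + c * binomialTransform n G
    ∎
  where
  distribute : ∀ r → ℕtoℚ (n C suc r) * (pow (- 1ℚ) r * (F r + c * G r))
                   ≡ ℕtoℚ (n C suc r) * (pow (- 1ℚ) r * F r) + c * (ℕtoℚ (n C suc r) * (pow (- 1ℚ) r * G r))
  distribute r = solve 5 (λ b s f c g → b :* (s :* (f :+ c :* g)) := b :* (s :* f) :+ c :* (b :* (s :* g)))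
                   refl (ℕtoℚ (n C suc r)) (pow (- 1ℚ) r) (F r) c (G r)

binomialTransform-pascal : ∀ n G → binomialTransform (suc n) G
  ≡ sumTo (suc n) (λ r → ℕtoℚ (n C r) * (pow (- 1ℚ) r * G r)) + binomialTransform n G
binomialTransform-pascal n G = begin
  binomialTransform (suc n) G
    ≡⟨ sumTo-cong (suc n) pascal ⟩
  sumTo (suc n) (λ r → ℕtoℚ (n C r) * t r + ℕtoℚ (n C suc r) * t r)
    ≡⟨ sumTo-+ (suc n) _ _ ⟩
  sumTo (suc n) (λ r → ℕtoℚ (n C r) * t r) + sumTo (suc n) (λ r → ℕtoℚ (n C suc r) * t r)
    ≡⟨ cong (_+_ (sumTo (suc n) (λ r → ℕtoℚ (n C r) * t r))) last-vanishes ⟩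
  sumTo (suc n) (λ r → ℕtoℚ (n C r) * t r) + binomialTransform n G
    ∎
  where
  t : ℕ → ℚ
  t r = pow (- 1ℚ) r * G r
  pascal : ∀ r → ℕtoℚ (suc n C suc r) * t r ≡ ℕtoℚ (n C r) * t r + ℕtoℚ (n C suc r) * t r
  pascal r = begin
    ℕtoℚ (suc n C suc r) * t r                    ≡⟨ cong (λ k → ℕtoℚ k * t r) (nCk+nC[k+1]≡[n+1]C[k+1] n r) ⟨
    ℕtoℚ (n C r ℕ.+ n C suc r) * t r              ≡⟨ cong (_* t r) (ℕtoℚ-+ (n C r) (n C suc r)) ⟩
    (ℕtoℚ (n C r) + ℕtoℚ (n C suc r)) * t r       ≡⟨ *-distribʳ-+ (t r) (ℕtoℚ (n C r)) (ℕtoℚ (n C suc r)) ⟩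
    ℕtoℚ (n C r) * t r + ℕtoℚ (n C suc r) * t r   ∎
  last-vanishes : binomialTransform n G + ℕtoℚ (n C suc n) * t n ≡ binomialTransform n G
  last-vanishes = begin
    binomialTransform n G + ℕtoℚ (n C suc n) * t n
      ≡⟨ cong (λ k → binomialTransform n G + ℕtoℚ k * t n) (k>n⇒nCk≡0 (ℕ.n<1+n n)) ⟩
    binomialTransform n G + 0ℚ * t n                 ≡⟨ cong (_+_ (binomialTransform n G)) (*-zeroˡ (t n)) ⟩
    binomialTransform n G + 0ℚ                       ≡⟨ +-identityʳ (binomialTransform n G) ⟩
    binomialTransform n G                            ∎

binomialTransform-suc : ∀ n G →
  binomialTransform (suc n) G ≡ G 0 - binomialTransform n (G ∘ suc) + binomialTransform n G
binomialTransform-suc n G = begin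
  binomialTransform (suc n) G
    ≡⟨ binomialTransform-pascal n G ⟩
  sumTo (suc n) (λ r → ℕtoℚ (n C r) * (pow (- 1ℚ) r * G r)) + binomialTransform n G
    ≡⟨ cong (_+ binomialTransform n G) (sumTo-suc n _) ⟩
  1ℚ * (1ℚ * G 0) + sumTo n (λ r → ℕtoℚ (n C suc r) * (- 1ℚ * pow (- 1ℚ) r * G (suc r))) + binomialTransform n G
    ≡⟨ cong₂ (λ a b → a + b + binomialTransform n G)
             (trans (*-identityˡ _) (*-identityˡ (G 0)))
             (trans (sumTo-cong n pull-sign) (sumTo-*ˡ n (- 1ℚ) _)) ⟩
  G 0 + - 1ℚ * binomialTransform n (G ∘ suc) + binomialTransform n G
    ≡⟨ cong (λ a → G 0 + a + binomialTransform n G) (-1*x≈-x (binomialTransform n (G ∘ suc))) ⟩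
  G 0 - binomialTransform n (G ∘ suc) + binomialTransform n G
    ∎
  where
  pull-sign : ∀ r → ℕtoℚ (n C suc r) * (- 1ℚ * pow (- 1ℚ) r * G (suc r))
                  ≡ - 1ℚ * (ℕtoℚ (n C suc r) * (pow (- 1ℚ) r * G (suc r)))
  pull-sign r = solve 4 (λ m b s g → b :* (m :* s :* g) := m :* (b :* (s :* g)))
                  refl (- 1ℚ) (ℕtoℚ (n C suc r)) (pow (- 1ℚ) r) (G (suc r))

binomialTransform-const : ∀ n → binomialTransform (suc n) (λ _ → 1ℚ) ≡ 1ℚ
binomialTransform-const n =
  trans (binomialTransform-suc n (λ _ → 1ℚ))
        (solve 2 (λ a b → a :- b :+ b := a) refl 1ℚ (binomialTransform n (λ _ → 1ℚ)))

binomialTransform-geom : ∀ y n → binomialTransform (suc n) (geom y) ≡ pow (1ℚ - y) n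
binomialTransform-geom y zero    = refl
binomialTransform-geom y (suc n) = begin
  binomialTransform (suc (suc n)) (geom y)
    ≡⟨ binomialTransform-suc (suc n) (geom y) ⟩
  1ℚ - binomialTransform (suc n) (geom y ∘ suc) + t
    ≡⟨ cong (λ b → 1ℚ - b + t) shifted ⟩
  1ℚ - (1ℚ + y * t) + t
    ≡⟨ solve 2 (λ y t → con 1ℚ :- (con 1ℚ :+ y :* t) :+ t := (con 1ℚ :- y) :* t) refl y t ⟩
  (1ℚ - y) * t
    ≡⟨ cong ((1ℚ - y) *_) (binomialTransform-geom y n) ⟩
  (1ℚ - y) * pow (1ℚ - y) n
    ∎
  where
  t : ℚ
  t = binomialTransform (suc n) (geom y)
  shifted : binomialTransform (suc n) (geom y ∘ suc) ≡ 1ℚ + y * t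
  shifted = begin
    binomialTransform (suc n) (geom y ∘ suc)                         ≡⟨ binomialTransform-cong (suc n) (geom-suc y) ⟩
    binomialTransform (suc n) (λ r → 1ℚ + y * geom y r)              ≡⟨ binomialTransform-linear (suc n) _ y (geom y) ⟩
    binomialTransform (suc n) (λ _ → 1ℚ) + y * t                     ≡⟨ cong (_+ y * t) (binomialTransform-const n) ⟩
    1ℚ + y * t                                                       ∎

binomialTransform-inv1+-suc : ∀ n G → binomialTransform (suc n) (λ r → inv1+ r * G r)
  ≡ inv1+ n * binomialTransform (suc n) G + binomialTransform n (λ r → inv1+ r * G r)
binomialTransform-inv1+-suc n G = begin
  binomialTransform (suc n) (λ r → inv1+ r * G r)
    ≡⟨ binomialTransform-pascal n _ ⟩
  sumTo (suc n) (λ r → ℕtoℚ (n C r) * (pow (- 1ℚ) r * (inv1+ r * G r))) + H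
    ≡⟨ cong (_+ H) (sumTo-cong (suc n) absorb) ⟨
  sumTo (suc n) (λ r → inv1+ n * (ℕtoℚ (suc n C suc r) * (pow (- 1ℚ) r * G r))) + H
    ≡⟨ cong (_+ H) (sumTo-*ˡ (suc n) (inv1+ n) _) ⟩
  inv1+ n * binomialTransform (suc n) G + H
    ∎
  where
  H : ℚ
  H = binomialTransform n (λ r → inv1+ r * G r)
  absorb : ∀ r → inv1+ n * (ℕtoℚ (suc n C suc r) * (pow (- 1ℚ) r * G r))
               ≡ ℕtoℚ (n C r) * (pow (- 1ℚ) r * (inv1+ r * G r))
  absorb r = begin
    inv1+ n * (ℕtoℚ (suc n C suc r) * (pow (- 1ℚ) r * G r))   ≡⟨ *-assoc (inv1+ n) _ _ ⟨
    inv1+ n * ℕtoℚ (suc n C suc r) * (pow (- 1ℚ) r * G r)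
      ≡⟨ cong (_* (pow (- 1ℚ) r * G r)) (nCk/[k+1]≡[n+1]C[k+1]/[n+1] n r) ⟨
    ℕtoℚ (n C r) * inv1+ r * (pow (- 1ℚ) r * G r)             ≡⟨ solve 4 (λ c i s g → c :* i :* (s :* g) := c :* (s :* (i :* g)))
                                                                   refl (ℕtoℚ (n C r)) (inv1+ r) (pow (- 1ℚ) r) (G r) ⟩
    ℕtoℚ (n C r) * (pow (- 1ℚ) r * (inv1+ r * G r))           ∎

sumTo-pow-inv1+ : ∀ x n → sumTo n (λ r → pow (1ℚ - x) r * inv1+ r)
                        ≡ binomialTransform n (λ r → inv1+ r * geom x r)
sumTo-pow-inv1+ x zero    = refl
sumTo-pow-inv1+ x (suc n) = begin
  sumTo n (λ r → pow (1ℚ - x) r * inv1+ r) + pow (1ℚ - x) n * inv1+ n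
    ≡⟨ cong₂ _+_ (sumTo-pow-inv1+ x n) (*-comm (pow (1ℚ - x) n) (inv1+ n)) ⟩
  H n + inv1+ n * pow (1ℚ - x) n
    ≡⟨ cong (λ p → H n + inv1+ n * p) (binomialTransform-geom x n) ⟨
  H n + inv1+ n * binomialTransform (suc n) (geom x)
    ≡⟨ +-comm (H n) _ ⟩
  inv1+ n * binomialTransform (suc n) (geom x) + H n
    ≡⟨ binomialTransform-inv1+-suc n (geom x) ⟨
  H (suc n)
    ∎
  where
  H : ℕ → ℚ
  H m = binomialTransform m (λ r → inv1+ r * geom x r)

lemma3 : (n : ℕ) → n ≥ 1 → (x : ℚ) →
    sumTo n (λ r → pow (1ℚ - x) r * inv1+ r)
      ≡ sumTo n (λ r → ℕtoℚ (n C suc r) * pow (- 1ℚ) r * inv1+ r * geom x r)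
lemma3 n _ x = trans (sumTo-pow-inv1+ x n) (sumTo-cong n reassociate)
  where
  reassociate : ∀ r → ℕtoℚ (n C suc r) * (pow (- 1ℚ) r * (inv1+ r * geom x r))
                    ≡ ℕtoℚ (n C suc r) * pow (- 1ℚ) r * inv1+ r * geom x r
  reassociate r = solve 4 (λ b s i g → b :* (s :* (i :* g)) := b :* s :* i :* g)
                    refl (ℕtoℚ (n C suc r)) (pow (- 1ℚ) r) (inv1+ r) (geom x r)
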